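{- Let $A$ be a nontrivial finite connected graph having a pendant vertex (a vertex of degree 1). Then the subdivision graph $S(A)$ is not 2-edge distance-balanced.
   Context: $S(A)$ is obtained from $A$ by inserting one new vertex into each edge of $A$, i.e. replacing each edge by a path of length 2. For a graph $X$, $d_X$ is shortest-path distance, and for a vertex $g$ and edge $f=xy$, $d_X(g,f)=\min\{d_X(g,x),d_X(g,y)\}$. $X$ is 2-edge distance-balanced if for all vertices $g,h$ with $d_X(g,h)=2$, $|\{f\in E(X): d_X(f,g)<d_X(f,h)\}|=|\{f\in E(X): d_X(f,h)<d_X(f,g)\}|$. -}

module Defs where

open import Data.Bool using (Bool; true; false; _∧_; _∨_; if_then_else_; T)
open import Data.Nat using (ℕ; zero; suc; _+_; _≤_; _<ᵇ_; _⊓_)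
open import Data.Fin using (Fin; toℕ; splitAt)
open import Data.Fin.Properties using (_≟_)
open import Data.List using (List; []; _∷_; length; filterᵇ; allFin; concatMap; map)
open import Data.Bool.ListAction using (any)
open import Data.Vec using (Vec; lookup; fromList)
open import Data.Product using (_×_; _,_; ∃; ∃-syntax)
open import Data.Sum using (inj₁; inj₂)
open import Relation.Nullary.Decidable using (⌊_⌋)
open import Relation.Binary.PropositionalEquality using (_≡_)

Graph : ℕ → Set
Graph n = Fin n → Fin n → Bool

record IsSimple {n : ℕ} (G : Graph n) : Set where
  field
    symmetric   : ∀ x y → G x y ≡ G y x
    irreflexive : ∀ x → G x x ≡ false

data Walk {n : ℕ} (G : Graph n) : Fin n → Fin n → ℕ → Set where
  here : ∀ {x} → Walk G x x 0
  step : ∀ {x y z k} → T (G x y) → Walk G y z k → Walk G x z (suc k)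

Connected : {n : ℕ} → Graph n → Set
Connected G = ∀ x y → ∃[ k ] Walk G x y k

degree : {n : ℕ} → Graph n → Fin n → ℕ
degree {n} G v = length (filterᵇ (G v) (allFin n))

edges : {n : ℕ} → Graph n → List (Fin n × Fin n)
edges {n} G =
  concatMap (λ i → map (λ j → (i , j))
                       (filterᵇ (λ j → (toℕ i <ᵇ toℕ j) ∧ G i j) (allFin n)))
            (allFin n)

reach : {n : ℕ} → Graph n → ℕ → Fin n → Fin n → Bool
reach G zero    x y = ⌊ x ≟ y ⌋
reach {n} G (suc k) x y =
  reach G k x y ∨ any (λ z → reach G k x z ∧ G z y) (allFin n)

-- Shortest-path distance: the least k with reach G k x y
-- (searched over k = 0 … n; in a connected graph on n vertices the
-- distance is < n, so this is the true distance).
dist : {n : ℕ} → Graph n → Fin n → Fin n → ℕ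
dist {n} G x y = go 0 n
  where
  go : ℕ → ℕ → ℕ
  go k zero    = k
  go k (suc f) = if reach G k x y then k else go (suc k) f

distE : {n : ℕ} → Graph n → Fin n → Fin n × Fin n → ℕ
distE G g (x , y) = dist G g x ⊓ dist G g y

closerEdges : {n : ℕ} → Graph n → Fin n → Fin n → ℕ
closerEdges G g h =
  length (filterᵇ (λ f → distE G g f <ᵇ distE G h f) (edges G))

TwoEdgeDistanceBalanced : {n : ℕ} → Graph n → Set
TwoEdgeDistanceBalanced G =
  ∀ g h → dist G g h ≡ 2 → closerEdges G g h ≡ closerEdges G h g

numEdges : {n : ℕ} → Graph n → ℕ
numEdges G = length (edges G)

-- Subdivision S(A): vertices Fin (n + m), m = |E(A)|; vertex (inject x) is the
-- original vertex x, vertex (n + e) is the new vertex on the e-th edge of A.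
isEnd : {n : ℕ} (A : Graph n) → Fin n → Fin (numEdges A) → Bool
isEnd A x e with lookup (fromList (edges A)) e
... | (a , b) = ⌊ a ≟ x ⌋ ∨ ⌊ b ≟ x ⌋

S : {n : ℕ} (A : Graph n) → Graph (n + numEdges A)
S {n} A u v with splitAt n u | splitAt n v
... | inj₁ x | inj₂ e = isEnd A x e
... | inj₂ e | inj₁ x = isEnd A x e
... | inj₁ _ | inj₁ _ = false
... | inj₂ _ | inj₂ _ = false

{-# OPTIONS --safe #-}
module Submission where

-- Let v be a pendant vertex of A with neighbour u, and w the vertex subdividing the edge vu,
-- so that d(v,u) = 2 in S(A). Every path leaving v runs through w, a neighbour of u, so u is at
-- least as close as v to every other vertex; hence vw is the only edge strictly closer to v.
-- On the other hand each edge joining u to a vertex that subdivides an edge at u is at distance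
-- 0 from u but not from v; since A is connected with at least three vertices, u has a neighbour
-- besides v, so there are at least two such edges.

open import Defs
open import Data.Bool using (Bool; true; false; T; _∧_; if_then_else_)
open import Data.Bool.Properties using (T-≡; T-∨; T-∧)
open import Data.Empty using (⊥-elim)
open import Data.Fin as Fin using (Fin; toℕ; splitAt; _↑ˡ_; _↑ʳ_; punchIn; punchOut)
open import Data.Fin.Properties
  using (_≟_; toℕ<n; toℕ-↑ˡ; toℕ-↑ʳ; ↑ˡ-injective; ↑ʳ-injective; toℕ-injective;
         splitAt-↑ˡ; splitAt-↑ʳ; splitAt⁻¹-↑ˡ; splitAt⁻¹-↑ʳ;
         punchInᵢ≢i; punchIn-injective; punchIn-punchOut)
open import Data.List using (List; []; _∷_; length; filterᵇ; allFin; map)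
open import Data.List.Membership.Propositional using (_∈_; lose)
open import Data.List.Membership.Propositional.Properties
  using (∈-allFin; ∈-filter⁺; ∈-filter⁻; ∈-map⁺; ∈-map⁻; ∈-concat⁺′; ∈-concat⁻′)
open import Data.List.Relation.Unary.All as All using (All; []; _∷_)
import Data.List.Relation.Unary.All.Properties as All
open import Data.List.Relation.Unary.Any using (here; there; satisfied)
open import Data.List.Relation.Unary.Any.Properties using (any⁺; any⁻)
open import Data.List.Relation.Unary.AllPairs as AllPairs using (AllPairs; []; _∷_)
import Data.List.Relation.Unary.AllPairs.Properties as AllPairs
open import Data.Vec.Relation.Unary.AllPairs using ([]; _∷_)
open import Data.List.Relation.Binary.Disjoint.Propositional using (Disjoint)
open import Data.List.Relation.Unary.Unique.Propositional using (Unique)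
import Data.List.Relation.Unary.Unique.Propositional.Properties as Unique
open import Data.Nat using (ℕ; zero; suc; _+_; _≤_; _<_; _<ᵇ_; z≤n; s≤s)
open import Data.Nat.Properties
  using (≤-refl; ≤-trans; n≤1+n; <-irrefl; <-trans; <⇒≢; ≤⇒≯; <ᵇ⇒<; <⇒<ᵇ;
         m≤m+n; ⊓-mono-≤; ⊓-glb; n≢0⇒n>0; <-cmp; module ≤-Reasoning)
open import Data.Product using (_×_; _,_; ∃-syntax; proj₁; proj₂; swap)
open import Data.Sum as Sum using (_⊎_; inj₁; inj₂)
open import Data.Unit using (tt)
open import Data.Vec using (lookup; fromList)
import Data.Vec.Membership.Propositional.Properties as Vec
import Data.Vec.Relation.Unary.All.Properties as VecAll
import Data.Vec.Relation.Unary.Any.Properties as VecAny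
import Data.Vec.Relation.Unary.Unique.Propositional as Vec
import Data.Vec.Relation.Unary.Unique.Propositional.Properties as VecUnique
open import Function using (_∘_; Equivalence)
open import Relation.Binary using (tri<; tri≈; tri>)
open import Relation.Binary.PropositionalEquality
open import Relation.Nullary using (¬_; yes; no; contradiction)
open import Relation.Nullary.Decidable using (T?; ⌊_⌋; toWitness; fromWitness; _⊎-dec_)
open import Relation.Unary using (Pred; Decidable)
open import Level using (0ℓ)

open Equivalence using (to; from)


¬T⇒≡false : ∀ {b} → ¬ T b → b ≡ false
¬T⇒≡false {false} _  = refl
¬T⇒≡false {true}  ¬t = contradiction tt ¬t

unique-constant⇒length≤1 : ∀ {A : Set} {c : A} {xs} → Unique xs → All (_≡ c) xs → length xs ≤ 1
unique-constant⇒length≤1 []                  []               = z≤n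
unique-constant⇒length≤1 (_ ∷ [])            (_ ∷ [])         = s≤s z≤n
unique-constant⇒length≤1 ((x≢y ∷ _) ∷ _)     (refl ∷ refl ∷ _) = ⊥-elim (x≢y refl)

filter-unique-witness⇒length≤1 : ∀ {A : Set} (p : A → Bool) {xs} (c : A) → Unique xs →
  (∀ {x} → x ∈ xs → T (p x) → x ≡ c) → length (filterᵇ p xs) ≤ 1
filter-unique-witness⇒length≤1 p {xs} c xs! only-c =
  unique-constant⇒length≤1 (Unique.filter⁺ (T? ∘ p) xs!)
    (All.tabulate λ x∈ → let x∈xs , px = ∈-filter⁻ (T? ∘ p) {xs = xs} x∈ in only-c x∈xs px)

distinct-members⇒2≤length : ∀ {A : Set} {xs : List A} {a b} → a ∈ xs → b ∈ xs → a ≢ b → 2 ≤ length xs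
distinct-members⇒2≤length (here refl) (here refl) a≢b = ⊥-elim (a≢b refl)
distinct-members⇒2≤length {xs = _ ∷ _ ∷ _} _ _ _ = s≤s (s≤s z≤n)
distinct-members⇒2≤length {xs = _ ∷ []} (here refl) (there ()) _
distinct-members⇒2≤length {xs = _ ∷ []} (there ()) _ _

lookup-fromList-∈ : ∀ {A : Set} (xs : List A) i → lookup (fromList xs) i ∈ xs
lookup-fromList-∈ xs i = Vec.∈-fromList⁻ (Vec.∈-lookup i (fromList xs))

∈⇒lookup-fromList : ∀ {A : Set} {xs : List A} {x} → x ∈ xs → ∃[ i ] lookup (fromList xs) i ≡ x
∈⇒lookup-fromList x∈xs = _ , sym (VecAny.lookup-index (Vec.∈-fromList⁺ x∈xs))

lookup-fromList-injective : ∀ {A : Set} {xs : List A} → Unique xs → ∀ i j →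
  lookup (fromList xs) i ≡ lookup (fromList xs) j → i ≡ j
lookup-fromList-injective xs! = VecUnique.lookup-injective (unique-fromList xs!)
  where
  unique-fromList : ∀ {A : Set} {xs : List A} → Unique xs → Vec.Unique (fromList xs)
  unique-fromList []           = []
  unique-fromList (x∉ ∷ xs!)   = VecAll.fromList⁺ x∉ ∷ unique-fromList xs!


module _ {n} (G : Graph n) where

  reach-refl : ∀ x → T (reach G 0 x x)
  reach-refl x = fromWitness refl

  reach₀⇒≡ : ∀ {x y} → T (reach G 0 x y) → x ≡ y
  reach₀⇒≡ = toWitness

  reach-suc : ∀ {k x y} → T (reach G k x y) → T (reach G (suc k) x y)
  reach-suc r = from T-∨ (inj₁ r)

  reach-step : ∀ {k x z y} → T (reach G k x z) → T (G z y) → T (reach G (suc k) x y)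
  reach-step {z = z} r e = from T-∨ (inj₂ (any⁺ _ (lose (∈-allFin z) (from T-∧ (r , e)))))

  reach-suc⁻ : ∀ {k x y} → T (reach G (suc k) x y) →
               T (reach G k x y) ⊎ ∃[ z ] T (reach G k x z) × T (G z y)
  reach-suc⁻ r with to T-∨ r
  ... | inj₁ r′ = inj₁ r′
  ... | inj₂ r′ with satisfied (any⁻ _ (allFin n) r′)
  ...   | z , rz∧e = inj₂ (z , to T-∧ rz∧e)

  adjacent⇒reach : ∀ {x y} → T (G x y) → ∀ k → T (reach G (suc k) x y)
  adjacent⇒reach {x} e zero    = reach-step {0} (reach-refl x) e
  adjacent⇒reach     e (suc k) = reach-suc {suc k} (adjacent⇒reach e k)

-- `search` is the local loop `go` of `dist`, which cannot be named from outside; the meta is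
-- solved by unification, and abstracting `suc N` and `1` makes that a pattern problem.
mutual
  search : ∀ {n} → Graph n → Fin n → Fin n → ℕ → ℕ → ℕ
  search = _

  dist-unfold : ∀ {N} (G : Graph (suc N)) x y →
                dist G x y ≡ (if reach G 0 x y then 0 else search G x y 1 N)
  dist-unfold {N} G x y with suc N | 1
  ... | _ | k = refl

module _ {n} (G : Graph n) where

  search-≥ : ∀ x y k f → k ≤ search G x y k f
  search-≥ x y k zero    = ≤-refl
  search-≥ x y k (suc f) with reach G k x y
  ... | true  = ≤-refl
  ... | false = ≤-trans (n≤1+n k) (search-≥ x y (suc k) f)

  search-mono : ∀ {x y z} → (∀ j → T (reach G j y z) → T (reach G j x z)) →
                ∀ k f → search G x z k f ≤ search G y z k f
  search-mono         reach⇒ k zero    = ≤-refl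
  search-mono {x} {y} {z} reach⇒ k (suc f) with reach G k y z in ry
  ... | true rewrite to T-≡ (reach⇒ k (from T-≡ ry)) = ≤-refl
  ... | false with reach G k x z
  ...   | true  = ≤-trans (n≤1+n k) (search-≥ y z (suc k) f)
  ...   | false = search-mono reach⇒ (suc k) f

  dist-mono : ∀ {x y z} → (∀ j → T (reach G j y z) → T (reach G j x z)) → dist G x z ≤ dist G y z
  dist-mono reach⇒ = search-mono reach⇒ 0 n

dist≡0⇒≡ : ∀ {n} (G : Graph n) {x y} → dist G x y ≡ 0 → x ≡ y
dist≡0⇒≡ {suc N} G {x} {y} d≡0 with reach G 0 x y in r
... | true  = reach₀⇒≡ G (from T-≡ r)
... | false = contradiction (subst (1 ≤_) d≡0 (search-≥ G x y 1 N)) λ ()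

dist-refl : ∀ {n} (G : Graph n) x → dist G x x ≡ 0
dist-refl {suc N} G x rewrite to T-≡ (reach-refl G x) = refl

dist≡2 : ∀ {n} (G : Graph n) {x y} → ¬ T (reach G 1 x y) → T (reach G 2 x y) → dist G x y ≡ 2
dist≡2 {1} G {Fin.zero} {Fin.zero} ¬r₁ _ = contradiction tt ¬r₁
-- With two vertices the search runs out of fuel at 2 before consulting `reach G 2`.
dist≡2 {2} G {x} {y} ¬r₁ _
  rewrite ¬T⇒≡false ¬r₁ | ¬T⇒≡false {⌊ x ≟ y ⌋} (¬r₁ ∘ reach-suc G {0}) = refl
dist≡2 {suc (suc (suc _))} G {x} {y} ¬r₁ r₂
  rewrite ¬T⇒≡false ¬r₁ | to T-≡ r₂ | ¬T⇒≡false {⌊ x ≟ y ⌋} (¬r₁ ∘ reach-suc G {0}) = refl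


∃-avoiding-two : ∀ {n} → 3 ≤ n → (u v : Fin n) → ∃[ z ] z ≢ u × z ≢ v
-- `punchIn u` avoids u; it avoids v too on every argument except the preimage j of v.
∃-avoiding-two (s≤s (s≤s (s≤s _))) u v with u ≟ v
... | yes refl = punchIn u Fin.zero , punchInᵢ≢i u Fin.zero , punchInᵢ≢i u Fin.zero
... | no u≢v   = punchIn u i , punchInᵢ≢i u i , i≢j ∘ punchIn-injective u i j ∘ via-j
  where
  j = punchOut u≢v
  i = punchIn j Fin.zero
  i≢j = punchInᵢ≢i j Fin.zero
  via-j : punchIn u i ≡ v → punchIn u i ≡ punchIn u j
  via-j eq = trans eq (sym (punchIn-punchOut u≢v))

walk-exits : ∀ {n} (G : Graph n) {P : Pred (Fin n) 0ℓ} → Decidable P →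
             ∀ {x z k} → Walk G x z k → P x → ¬ P z → ∃[ a ] ∃[ b ] P a × ¬ P b × T (G a b)
walk-exits G P? here             Px ¬Pz = contradiction Px ¬Pz
walk-exits G P? (step {y = y} xy w) Px ¬Pz with P? y
... | yes Py  = walk-exits G P? w Py ¬Pz
... | no  ¬Py = _ , y , Px , ¬Py , xy

degree≡1⇒unique-neighbour : ∀ {n} (G : Graph n) {v} → degree G v ≡ 1 →
                            ∃[ u ] T (G v u) × (∀ {y} → T (G v y) → y ≡ u)
degree≡1⇒unique-neighbour {n} G {v} _ with filterᵇ (G v) (allFin n) in eq
degree≡1⇒unique-neighbour {n} G {v} refl | u ∷ [] =
  u , proj₂ (∈-filter⁻ (T? ∘ G v) {xs = allFin n} (subst (u ∈_) (sym eq) (here refl))) , only-u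
  where
  only-u : ∀ {y} → T (G v y) → y ≡ u
  only-u vy with subst (_ ∈_) eq (∈-filter⁺ (T? ∘ G v) (∈-allFin _) vy)
  ... | here y≡u = y≡u


module _ {n} (G : Graph n) where

  private
    Above : Fin n → Fin n → Bool
    Above i j = (toℕ i <ᵇ toℕ j) ∧ G i j

    row : Fin n → List (Fin n × Fin n)
    row i = map (i ,_) (filterᵇ (Above i) (allFin n))

    row-fst : ∀ {i e} → e ∈ row i → proj₁ e ≡ i
    row-fst {i} e∈ with ∈-map⁻ (i ,_) e∈
    ... | _ , _ , refl = refl

  ∈-edges⁻ : ∀ {a b} → (a , b) ∈ edges G → toℕ a < toℕ b × T (G a b)
  ∈-edges⁻ ab∈ with ∈-concat⁻′ (map row (allFin n)) ab∈
  ... | _ , ab∈row , row∈ with ∈-map⁻ row row∈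
  ... | i , _ , refl with ∈-map⁻ (i ,_) ab∈row
  ... | j , j∈ , refl with to T-∧ (proj₂ (∈-filter⁻ (T? ∘ Above i) {xs = allFin n} j∈))
  ... | i<j , e = <ᵇ⇒< _ _ i<j , e

  ∈-edges⁺ : ∀ {a b} → toℕ a < toℕ b → T (G a b) → (a , b) ∈ edges G
  ∈-edges⁺ {a} {b} a<b e =
    ∈-concat⁺′ (∈-map⁺ (a ,_) (∈-filter⁺ (T? ∘ Above a) (∈-allFin b) (from T-∧ (<⇒<ᵇ a<b , e))))
               (∈-map⁺ row (∈-allFin a))

  edges-unique : Unique (edges G)
  edges-unique = Unique.concat⁺ (All.map⁺ (All.universal row-unique _)) rows-disjoint
    where
    row-unique : ∀ i → Unique (row i)
    row-unique i = Unique.map⁺ (cong proj₂) (Unique.filter⁺ (T? ∘ Above i) (Unique.allFin⁺ n))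

    rows-disjoint : AllPairs Disjoint (map row (allFin n))
    rows-disjoint = AllPairs.map⁺ (AllPairs.map
      (λ i≢j {_} (e∈i , e∈j) → i≢j (trans (sym (row-fst e∈i)) (row-fst e∈j))) (Unique.allFin⁺ n))


module Subdivision {n} (A : Graph n) where

  orig : Fin n → Fin (n + numEdges A)
  orig x = x ↑ˡ numEdges A

  new : Fin (numEdges A) → Fin (n + numEdges A)
  new e = n ↑ʳ e

  ends : Fin (numEdges A) → Fin n × Fin n
  ends e = lookup (fromList (edges A)) e

  orig-or-new : ∀ a → (∃[ x ] a ≡ orig x) ⊎ (∃[ e ] a ≡ new e)
  orig-or-new a with splitAt n a in eq
  ... | inj₁ x = inj₁ (x , sym (splitAt⁻¹-↑ˡ eq))
  ... | inj₂ e = inj₂ (e , sym (splitAt⁻¹-↑ʳ eq))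

  toℕ-orig<toℕ-new : ∀ x e → toℕ (orig x) < toℕ (new e)
  toℕ-orig<toℕ-new x e rewrite toℕ-↑ˡ x (numEdges A) | toℕ-↑ʳ n e =
    ≤-trans (toℕ<n x) (m≤m+n n (toℕ e))

  orig≢new : ∀ x e → orig x ≢ new e
  orig≢new x e eq = <⇒≢ (toℕ-orig<toℕ-new x e) (cong toℕ eq)

  S-orig-orig : ∀ x y → S A (orig x) (orig y) ≡ false
  S-orig-orig x y rewrite splitAt-↑ˡ n x (numEdges A) | splitAt-↑ˡ n y (numEdges A) = refl

  S-orig-new : ∀ x e → S A (orig x) (new e) ≡ isEnd A x e
  S-orig-new x e rewrite splitAt-↑ˡ n x (numEdges A) | splitAt-↑ʳ n (numEdges A) e = refl

  S-sym : ∀ a b → S A a b ≡ S A b a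
  S-sym a b with splitAt n a | splitAt n b
  ... | inj₁ _ | inj₁ _ = refl
  ... | inj₁ _ | inj₂ _ = refl
  ... | inj₂ _ | inj₁ _ = refl
  ... | inj₂ _ | inj₂ _ = refl

  ends-ordered : ∀ e → toℕ (proj₁ (ends e)) < toℕ (proj₂ (ends e))
  ends-ordered e = proj₁ (∈-edges⁻ A (lookup-fromList-∈ (edges A) e))

  ends-adjacent : ∀ e → T (A (proj₁ (ends e)) (proj₂ (ends e)))
  ends-adjacent e = proj₂ (∈-edges⁻ A (lookup-fromList-∈ (edges A) e))

  isEnd⁻ : ∀ {x e} → T (isEnd A x e) → x ≡ proj₁ (ends e) ⊎ x ≡ proj₂ (ends e)
  isEnd⁻ {x} {e} x∈e with proj₁ (ends e) ≟ x | proj₂ (ends e) ≟ x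
  ... | yes p≡x | _       = inj₁ (sym p≡x)
  ... | no _    | yes q≡x = inj₂ (sym q≡x)

  isEnd-fst : ∀ e → T (isEnd A (proj₁ (ends e)) e)
  isEnd-fst e with proj₁ (ends e) ≟ proj₁ (ends e)
  ... | yes _   = tt
  ... | no p≢p  = contradiction refl p≢p

  isEnd-snd : ∀ e → T (isEnd A (proj₂ (ends e)) e)
  isEnd-snd e with proj₁ (ends e) ≟ proj₂ (ends e) | proj₂ (ends e) ≟ proj₂ (ends e)
  ... | yes _ | _      = tt
  ... | no _  | yes _  = tt
  ... | no _  | no q≢q = contradiction refl q≢q

  ends-of-distinct : ∀ {a b e} → a ≢ b → T (isEnd A a e) → T (isEnd A b e) →
    (ends e ≡ (a , b) × toℕ a < toℕ b) ⊎ (ends e ≡ (b , a) × toℕ b < toℕ a)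
  ends-of-distinct {e = e} a≢b a∈e b∈e with isEnd⁻ a∈e | isEnd⁻ b∈e
  ... | inj₁ refl | inj₂ refl = inj₁ (refl , ends-ordered e)
  ... | inj₂ refl | inj₁ refl = inj₂ (refl , ends-ordered e)
  ... | inj₁ refl | inj₁ refl = contradiction refl a≢b
  ... | inj₂ refl | inj₂ refl = contradiction refl a≢b

  ends-determine-edge : ∀ {a b e e′} → a ≢ b → T (isEnd A a e) → T (isEnd A b e) →
                        T (isEnd A a e′) → T (isEnd A b e′) → e ≡ e′
  ends-determine-edge {e = e} {e′} a≢b a∈e b∈e a∈e′ b∈e′
    with ends-of-distinct a≢b a∈e b∈e | ends-of-distinct a≢b a∈e′ b∈e′
  ... | inj₁ (eq , _)   | inj₁ (eq′ , _)  = lookup-fromList-injective (edges-unique A) e e′ (trans eq (sym eq′))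
  ... | inj₂ (eq , _)   | inj₂ (eq′ , _)  = lookup-fromList-injective (edges-unique A) e e′ (trans eq (sym eq′))
  ... | inj₁ (_ , a<b)  | inj₂ (_ , b<a)  = contradiction (<-trans a<b b<a) (<-irrefl refl)
  ... | inj₂ (_ , b<a)  | inj₁ (_ , a<b)  = contradiction (<-trans a<b b<a) (<-irrefl refl)

  at-most-two-ends : ∀ {a b c e} → a ≢ b → T (isEnd A a e) → T (isEnd A b e) → T (isEnd A c e) →
                     c ≡ a ⊎ c ≡ b
  at-most-two-ends a≢b a∈e b∈e c∈e with ends-of-distinct a≢b a∈e b∈e | isEnd⁻ c∈e
  ... | inj₁ (refl , _) | inj₁ c≡a = inj₁ c≡a
  ... | inj₁ (refl , _) | inj₂ c≡b = inj₂ c≡b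
  ... | inj₂ (refl , _) | inj₁ c≡b = inj₂ c≡b
  ... | inj₂ (refl , _) | inj₂ c≡a = inj₁ c≡a

  ends≡⇒isEnd : ∀ {a b e} → ends e ≡ (a , b) → T (isEnd A a e) × T (isEnd A b e)
  ends≡⇒isEnd {e = e} eq =
    subst (λ p → T (isEnd A (proj₁ p) e)) eq (isEnd-fst e) ,
    subst (λ p → T (isEnd A (proj₂ p) e)) eq (isEnd-snd e)

  module _ (simple : IsSimple A) where
    open IsSimple simple

    adjacent⇒common-edge : ∀ {a b} → T (A a b) → ∃[ e ] T (isEnd A a e) × T (isEnd A b e)
    adjacent⇒common-edge {a} {b} ab with <-cmp (toℕ a) (toℕ b)
    ... | tri< a<b _ _ = let e , eq = ∈⇒lookup-fromList (∈-edges⁺ A a<b ab) in e , ends≡⇒isEnd eq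
    ... | tri> _ _ b<a = let e , eq = ∈⇒lookup-fromList (∈-edges⁺ A b<a (subst T (symmetric a b) ab))
                         in e , swap (ends≡⇒isEnd eq)
    ... | tri≈ _ a≡b _ with toℕ-injective a≡b
    ...   | refl = ⊥-elim (subst T (irreflexive a) ab)

    other-end : ∀ {x e} → T (isEnd A x e) → ∃[ y ] T (A x y) × T (isEnd A y e)
    other-end {e = e} x∈e with isEnd⁻ x∈e
    ... | inj₁ refl = proj₂ (ends e) , ends-adjacent e , isEnd-snd e
    ... | inj₂ refl = proj₁ (ends e) , subst T (symmetric _ _) (ends-adjacent e) , isEnd-fst e


module Pendant {n} (A : Graph n) (simple : IsSimple A) {v u : Fin n}
               (vu : T (A v u)) (only-u : ∀ {y} → T (A v y) → y ≡ u) where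
  open Subdivision A
  open IsSimple simple

  V U : Fin (n + numEdges A)
  V = orig v
  U = orig u

  v≢u : v ≢ u
  v≢u refl = subst T (irreflexive v) vu

  V≢U : V ≢ U
  V≢U = v≢u ∘ ↑ˡ-injective (numEdges A) v u

  e₀ : Fin (numEdges A)
  e₀ = proj₁ (adjacent⇒common-edge simple vu)

  v∈e₀ : T (isEnd A v e₀)
  v∈e₀ = proj₁ (proj₂ (adjacent⇒common-edge simple vu))

  u∈e₀ : T (isEnd A u e₀)
  u∈e₀ = proj₂ (proj₂ (adjacent⇒common-edge simple vu))

  W : Fin (n + numEdges A)
  W = new e₀

  adjacent-orig-new : ∀ {x e} → T (isEnd A x e) → T (S A (orig x) (new e))
  adjacent-orig-new {x} {e} = subst T (sym (S-orig-new x e))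

  neighbour-of-V : ∀ {z} → T (S A V z) → z ≡ W
  neighbour-of-V {z} Vz with orig-or-new z
  ... | inj₁ (x , refl) = ⊥-elim (subst T (S-orig-orig v x) Vz)
  ... | inj₂ (e , refl) with other-end simple (subst T (S-orig-new v e) Vz)
  ...   | y , vy , y∈e with only-u vy
  ...     | refl = cong new (ends-determine-edge v≢u (subst T (S-orig-new v e) Vz) y∈e v∈e₀ u∈e₀)

  -- Every walk out of V passes through W, a neighbour of U.
  reach-V⇒reach-U : ∀ k {z} → z ≢ V → T (reach (S A) k V z) → T (reach (S A) k U z)
  reach-V⇒reach-U zero        z≢V r = contradiction (sym (reach₀⇒≡ (S A) r)) z≢V
  reach-V⇒reach-U (suc k) {z} z≢V r with reach-suc⁻ (S A) {k} r
  ... | inj₁ r′ = reach-suc (S A) {k} {U} {z} (reach-V⇒reach-U k z≢V r′)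
  ... | inj₂ (y , r′ , yz) with y ≟ V
  ...   | no y≢V = reach-step (S A) {k} {U} (reach-V⇒reach-U k y≢V r′) yz
  ...   | yes refl with neighbour-of-V yz
  ...     | refl = adjacent⇒reach (S A) (adjacent-orig-new u∈e₀) k

  dist-U≤dist-V : ∀ {z} → z ≢ V → dist (S A) U z ≤ dist (S A) V z
  dist-U≤dist-V z≢V = dist-mono (S A) (λ j → reach-V⇒reach-U j z≢V)

  closer-to-V⇒≡VW : ∀ {f} → f ∈ edges (S A) → T (distE (S A) V f <ᵇ distE (S A) U f) → f ≡ (V , W)
  closer-to-V⇒≡VW {a , b} f∈ closer with ∈-edges⁻ (S A) f∈ | a ≟ V | b ≟ V
  ... | _ , ab | yes refl | _ = cong (V ,_) (neighbour-of-V ab)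
  ... | a<b , ab | no _ | yes refl with neighbour-of-V (subst T (S-sym a V) ab)
  ...   | refl = contradiction (<-trans (toℕ-orig<toℕ-new v e₀) a<b) (<-irrefl refl)
  closer-to-V⇒≡VW {a , b} f∈ closer | _ | no a≢V | no b≢V =
    contradiction (<ᵇ⇒< _ _ closer) (≤⇒≯ (⊓-mono-≤ (dist-U≤dist-V a≢V) (dist-U≤dist-V b≢V)))

  closerEdges-V≤1 : closerEdges (S A) V U ≤ 1
  closerEdges-V≤1 = filter-unique-witness⇒length≤1 _ (V , W) (edges-unique (S A)) closer-to-V⇒≡VW

  incident-to-U-closer : ∀ {e} → T (distE (S A) U (U , new e) <ᵇ distE (S A) V (U , new e))
  incident-to-U-closer {e} rewrite dist-refl (S A) U =
    <⇒<ᵇ (⊓-glb (n≢0⇒n>0 (V≢U ∘ dist≡0⇒≡ (S A))) (n≢0⇒n>0 (orig≢new v e ∘ dist≡0⇒≡ (S A))))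

  2≤closerEdges-U : ∀ {y} → T (A u y) → y ≢ v → 2 ≤ closerEdges (S A) U V
  2≤closerEdges-U {y} uy y≢v with adjacent⇒common-edge simple uy
  ... | e₁ , u∈e₁ , y∈e₁ = distinct-members⇒2≤length (closer u∈e₀) (closer u∈e₁) UW≢Ue₁
    where
    closer : ∀ {e} → T (isEnd A u e) →
             (U , new e) ∈ filterᵇ (λ f → distE (S A) U f <ᵇ distE (S A) V f) (edges (S A))
    closer {e} u∈e = ∈-filter⁺ (T? ∘ _) (∈-edges⁺ (S A) (toℕ-orig<toℕ-new u e) (adjacent-orig-new u∈e))
                                       incident-to-U-closer

    UW≢Ue₁ : (U , W) ≢ (U , new e₁)
    UW≢Ue₁ eq with ↑ʳ-injective n e₀ e₁ (cong proj₂ eq)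
    ... | refl with at-most-two-ends v≢u v∈e₀ u∈e₀ y∈e₁
    ...   | inj₁ y≡v  = y≢v y≡v
    ...   | inj₂ refl = subst T (irreflexive u) uy

  dist-V-U≡2 : dist (S A) V U ≡ 2
  dist-V-U≡2 = dist≡2 (S A) ¬reach₁ reach₂
    where
    ¬reach₁ : ¬ T (reach (S A) 1 V U)
    ¬reach₁ r with reach-suc⁻ (S A) {0} r
    ... | inj₁ r₀ = V≢U (reach₀⇒≡ (S A) r₀)
    ... | inj₂ (z , r₀ , zU) with reach₀⇒≡ (S A) r₀
    ...   | refl = subst T (S-orig-orig v u) zU

    reach₂ : T (reach (S A) 2 V U)
    reach₂ = reach-step (S A) {1} (adjacent⇒reach (S A) (adjacent-orig-new v∈e₀) 0)
                                  (subst T (S-sym U W) (adjacent-orig-new u∈e₀))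

  not-2-edge-distance-balanced : ∀ {y} → T (A u y) → y ≢ v → ¬ TwoEdgeDistanceBalanced (S A)
  not-2-edge-distance-balanced uy y≢v balanced = contradiction 2≤1 λ { (s≤s ()) }
    where
    open ≤-Reasoning
    2≤1 : 2 ≤ 1
    2≤1 = begin
      2                      ≤⟨ 2≤closerEdges-U uy y≢v ⟩
      closerEdges (S A) U V  ≡⟨ balanced V U dist-V-U≡2 ⟨
      closerEdges (S A) V U  ≤⟨ closerEdges-V≤1 ⟩
      1                      ∎

  second-neighbour-of-u : 3 ≤ n → Connected A → ∃[ y ] T (A u y) × y ≢ v
  second-neighbour-of-u 3≤n connected with ∃-avoiding-two 3≤n u v
  ... | z , z≢u , z≢v
    with walk-exits A (λ x → x ≟ u ⊎-dec x ≟ v) (proj₂ (connected u z)) (inj₁ refl) (Sum.[_,_] z≢u z≢v)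
  ... | _ , y , inj₁ refl , y∉uv , uy = y , uy , y∉uv ∘ inj₂
  ... | _ , y , inj₂ refl , y∉uv , vy = contradiction (inj₁ (only-u vy)) y∉uv

theorem6 : (n : ℕ) (A : Graph n) → IsSimple A → 3 ≤ n → Connected A →
    (∃[ v ] degree A v ≡ 1) → ¬ TwoEdgeDistanceBalanced (S A)
theorem6 n A simple 3≤n connected (v , deg-v≡1) =
  let u , vu , only-u = degree≡1⇒unique-neighbour A deg-v≡1
      open Pendant A simple vu only-u
      y , uy , y≢v = second-neighbour-of-u 3≤n connected
  in not-2-edge-distance-balanced uy y≢v
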